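{- Let $G$ be a finite simple graph with at least one vertex and let $\kappa:V(G)\to\mathbb{N}\cup\{0\}$. (i) If $G$ is $\kappa$-degenerate, then there exists a vertex $v$ of $G$ with $0\le \kappa(v)-\deg_G(v)\le \sum_{u\in V(G)}\kappa(u)-|E(G)|$. (ii) If $v$ is a vertex of $G$ with $0\le \kappa(v)-\deg_G(v)\le \sum_{u\in V(G)}\kappa(u)-|E(G)|$, then $G$ is $\kappa$-degenerate if and only if $G\setminus\{v\}$ is $\kappa'$-degenerate, where $\kappa'$ is the restriction of $\kappa$ to $V(G)\setminus\{v\}$.
   Context: For a graph $H$ and a function $\kappa: V(H)\to\mathbb{N}\cup\{0\}$, $H$ is called $\kappa$-degenerate if its vertices can be ordered $v_1,\dots,v_h$ so that for every $i$, the degree of $v_i$ in the subgraph of $H$ induced by $\{v_1,\dots,v_i\}$ is at most $\kappa(v_i)$. -}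

module Defs where

open import Data.Nat using (ℕ; suc; _≤_; _+_)
open import Data.Fin using (Fin; _<?_; punchIn)
open import Data.Bool using (Bool; true; false; if_then_else_; _∧_; T)
open import Data.List using (map; allFin)
open import Data.Nat.ListAction using (sum)
open import Data.Product using (Σ; _×_)
open import Data.Fin.Permutation using (Permutation′; _⟨$⟩ʳ_)
open import Relation.Nullary using (does)
open import Relation.Binary.PropositionalEquality using (_≡_)

record Graph (n : ℕ) : Set where
  field
    adj    : Fin n → Fin n → Bool
    sym    : ∀ u v → adj u v ≡ adj v u
    irrefl : ∀ v → adj v v ≡ false
open Graph public

sumFin : {n : ℕ} → (Fin n → ℕ) → ℕ
sumFin {n} f = sum (map f (allFin n))

ind : Bool → ℕ
ind b = if b then 1 else 0

deg : {n : ℕ} → Graph n → Fin n → ℕ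
deg G v = sumFin (λ u → ind (adj G v u))

numEdges : {n : ℕ} → Graph n → ℕ
numEdges G = sumFin (λ i → sumFin (λ j → ind (does (i <? j) ∧ adj G i j)))

-- H is κ-degenerate: there is an ordering v_1..v_h (a permutation σ, v_i = σ i)
-- such that the degree of v_i in the subgraph induced by {v_1..v_i},
-- i.e. the number of j < i with v_j adjacent to v_i, is at most κ(v_i).
Degenerate : {n : ℕ} → Graph n → (Fin n → ℕ) → Set
Degenerate {n} G κ =
  Σ (Permutation′ n) λ σ → ∀ i →
    sumFin (λ j → ind (does (j <? i) ∧ adj G (σ ⟨$⟩ʳ j) (σ ⟨$⟩ʳ i))) ≤ κ (σ ⟨$⟩ʳ i)

deleteVertex : {n : ℕ} → Graph (suc n) → Fin (suc n) → Graph n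
deleteVertex G v = record
  { adj    = λ i j → adj G (punchIn v i) (punchIn v j)
  ; sym    = λ i j → sym G (punchIn v i) (punchIn v j)
  ; irrefl = λ i → irrefl G (punchIn v i)
  }

restrict : {n : ℕ} → (Fin (suc n) → ℕ) → Fin (suc n) → (Fin n → ℕ)
restrict κ v i = κ (punchIn v i)

-- 0 ≤ κ(v) - deg(v) ≤ Σ κ - |E(G)| (over ℤ), stated equivalently in ℕ:
-- deg(v) ≤ κ(v)  and  κ(v) + |E(G)| ≤ Σ κ + deg(v).
GoodVertex : {n : ℕ} → Graph n → (Fin n → ℕ) → Fin n → Set
GoodVertex G κ v = (deg G v ≤ κ v) × (κ v + numEdges G ≤ sumFin κ + deg G v)

-- Order the vertices by a degenerate ordering σ and count each edge at its later
-- endpoint: |E(G)| is the sum of the back-degrees, whatever σ is. The last vertex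
-- v = σ(last) has back-degree deg(v) ≤ κ(v), and every other back-degree is at most
-- κ, which gives (i). For (ii), deleting v from a degenerate ordering only lowers
-- back-degrees; conversely, appending v to a degenerate ordering of G \ {v} leaves
-- the old back-degrees unchanged and gives v back-degree deg(v) ≤ κ(v).
module Submission where

open import Defs hiding (sym)
open import Data.Nat using (ℕ; suc; _≤_; _+_; z≤n; ⌊_/2⌋)
open import Data.Nat.Properties as ℕ
  using (+-0-commutativeMonoid; +-identityʳ; +-comm; +-assoc; +-mono-≤; +-monoʳ-≤; m≤n+m; ≮⇒≥)
open import Data.Nat.ListAction using (sum)
open import Data.Fin using (Fin; zero; suc; _<_; _<?_; _≟_; punchIn; punchOut; fromℕ)
open import Data.Fin.Properties
  using (<-asym; ≤-antisym; ≤fromℕ; punchIn-mono-≤; punchIn-cancel-≤; punchIn-punchOut)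
open import Data.Fin.Permutation as Perm using (Permutation′; _⟨$⟩ʳ_; _⟨$⟩ˡ_; insert; remove)
open import Data.Bool using (Bool; false; _∧_)
open import Data.List using (map; tabulate)
open import Data.List.Properties using (map-tabulate)
open import Data.Product using (Σ; _×_; _,_; proj₁; proj₂)
open import Data.Sum using (_⊎_; inj₁; inj₂; [_,_]′)
open import Data.Empty using (⊥-elim)
open import Function.Base using (id; _∘_)
open import Function.Bundles using (_⇔_; mk⇔)
open import Relation.Nullary using (Dec; does; yes; no; ¬_)
open import Relation.Nullary.Decidable using (does-⇔; dec-yes; dec-false)
open import Relation.Binary.PropositionalEquality
  using (_≡_; refl; sym; trans; cong; cong₂; subst; module ≡-Reasoning)
open import Algebra.Properties.CommutativeMonoid.Sum +-0-commutativeMonoid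
  using (sum-syntax; sum-cong-≗; ∑-comm; ∑-distrib-+; ∑-permute; sum-remove)
  renaming (sum to ∑)

private
  variable
    m n : ℕ

sumFin≡∑ : (f : Fin m → ℕ) → sumFin f ≡ ∑ f
sumFin≡∑ {m} f = trans (cong sum (map-tabulate id f)) (sum-tabulate f)
  where
  sum-tabulate : ∀ {k} (g : Fin k → ℕ) → sum (tabulate g) ≡ ∑ g
  sum-tabulate {ℕ.zero} g = refl
  sum-tabulate {suc k} g = cong (g zero +_) (sum-tabulate (g ∘ suc))

∑-mono-≤ : {f g : Fin m → ℕ} → (∀ i → f i ≤ g i) → ∑ f ≤ ∑ g
∑-mono-≤ {ℕ.zero} f≤g = z≤n
∑-mono-≤ {suc m} f≤g = +-mono-≤ (f≤g zero) (∑-mono-≤ (f≤g ∘ suc))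

+-self-injective : ∀ {a b} → a + a ≡ b + b → a ≡ b
+-self-injective {a} {b} eq = trans (ℕ.n≡⌊n+n/2⌋ a) (trans (cong ⌊_/2⌋ eq) (sym (ℕ.n≡⌊n+n/2⌋ b)))

punchIn-<-does : (i : Fin (suc m)) (j k : Fin m) → does (punchIn i j <? punchIn i k) ≡ does (j <? k)
punchIn-<-does i j k = does-⇔ (mk⇔ from to) (punchIn i j <? punchIn i k) (j <? k)
  where
  to : j < k → punchIn i j < punchIn i k
  to j<k = ℕ.≰⇒> (λ pk≤pj → ℕ.<⇒≱ j<k (punchIn-cancel-≤ i k j pk≤pj))
  from : punchIn i j < punchIn i k → j < k
  from pj<pk = ℕ.≰⇒> (λ k≤j → ℕ.<⇒≱ pj<pk (punchIn-mono-≤ i k j k≤j))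

fromℕ-≮ : (j : Fin (suc n)) → ¬ (fromℕ n < j)
fromℕ-≮ j = ℕ.≤⇒≯ (≤fromℕ j)

≮fromℕ⇒≡fromℕ : (j : Fin (suc n)) → ¬ (j < fromℕ n) → j ≡ fromℕ n
≮fromℕ⇒≡fromℕ j j≮ = ≤-antisym (≤fromℕ j) (≮⇒≥ j≮)

≡-or-punchIn : (i j : Fin (suc n)) → i ≡ j ⊎ Σ (Fin n) (λ k → punchIn i k ≡ j)
≡-or-punchIn i j with i ≟ j
... | yes i≡j = inj₁ i≡j
... | no i≢j  = inj₂ (punchOut i≢j , punchIn-punchOut i≢j)

insert-self : (i j : Fin (suc m)) (π : Permutation′ m) → insert i j π ⟨$⟩ʳ i ≡ j
insert-self i j π rewrite proj₂ (dec-yes (i ≟ i) refl) = refl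

ind-split-dec : {P Q : Set} (p : Dec P) (q : Dec Q) (x : Bool) →
  (P → ¬ Q) → (¬ P → ¬ Q → x ≡ false) → ind x ≡ ind (does p ∧ x) + ind (does q ∧ x)
ind-split-dec (yes p) (yes q) x p⇒¬q _ = ⊥-elim (p⇒¬q p q)
ind-split-dec (yes _) (no _)  x _ _ = sym (+-identityʳ _)
ind-split-dec (no _)  (yes _) x _ _ = refl
ind-split-dec (no ¬p) (no ¬q) x _ neither = cong ind (neither ¬p ¬q)

ind-does-∧ : {P : Set} (p : Dec P) (x y : Bool) → (P → x ≡ y) → (¬ P → y ≡ false) → ind (does p ∧ x) ≡ ind y
ind-does-∧ (yes p) x y x≡y _ = cong ind (x≡y p)
ind-does-∧ (no ¬p) x y _ y≡false = cong ind (sym (y≡false ¬p))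

module _ (r : Fin m → Fin m → Bool) where

  lowerSum : ℕ
  lowerSum = ∑[ i < m ] ∑[ j < m ] ind (does (j <? i) ∧ r j i)

  fullSum : ℕ
  fullSum = ∑[ i < m ] ∑[ j < m ] ind (r j i)

  module _ (r-sym : ∀ i j → r i j ≡ r j i) (r-irrefl : ∀ i → r i i ≡ false) where

    ind-split : ∀ i j → ind (r j i) ≡ ind (does (j <? i) ∧ r j i) + ind (does (i <? j) ∧ r j i)
    ind-split i j = ind-split-dec (j <? i) (i <? j) (r j i) <-asym diagonal
      where
      diagonal : ¬ (j < i) → ¬ (i < j) → r j i ≡ false
      diagonal j≮i i≮j with ≤-antisym (≮⇒≥ i≮j) (≮⇒≥ j≮i)
      ... | refl = r-irrefl i

    lowerSum≡upperSum : lowerSum ≡ ∑[ i < m ] ∑[ j < m ] ind (does (i <? j) ∧ r j i)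
    lowerSum≡upperSum = trans (∑-comm (λ i j → ind (does (j <? i) ∧ r j i)))
      (sum-cong-≗ λ i → sum-cong-≗ λ j → cong (λ b → ind (does (i <? j) ∧ b)) (r-sym i j))

    lowerSum-double : lowerSum + lowerSum ≡ fullSum
    lowerSum-double = begin
      lowerSum + lowerSum
        ≡⟨ cong (lowerSum +_) lowerSum≡upperSum ⟩
      ∑ (λ i → ∑ (below i)) + ∑ (λ i → ∑ (above i))
        ≡⟨ sym (∑-distrib-+ (λ i → ∑ (below i)) (λ i → ∑ (above i))) ⟩
      ∑ (λ i → ∑ (below i) + ∑ (above i))
        ≡⟨ sum-cong-≗ (λ i → trans (sym (∑-distrib-+ (below i) (above i))) (sum-cong-≗ (sym ∘ ind-split i))) ⟩
      fullSum ∎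
      where
      open ≡-Reasoning
      below above : Fin m → Fin m → ℕ
      below i j = ind (does (j <? i) ∧ r j i)
      above i j = ind (does (i <? j) ∧ r j i)

-- Being symmetric with zero diagonal, r's lower triangle is half of it, so the
-- lower-triangle sum does not depend on the order of the rows and columns.
lowerSum-permute : (r : Fin m → Fin m → Bool) →
  (∀ i j → r i j ≡ r j i) → (∀ i → r i i ≡ false) → (σ : Permutation′ m) →
  lowerSum (λ j i → r (σ ⟨$⟩ʳ j) (σ ⟨$⟩ʳ i)) ≡ lowerSum r
lowerSum-permute r r-sym r-irrefl σ = +-self-injective (begin
  lowerSum rσ + lowerSum rσ
    ≡⟨ lowerSum-double rσ (λ i j → r-sym (σ ⟨$⟩ʳ i) _) (r-irrefl ∘ (σ ⟨$⟩ʳ_)) ⟩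
  fullSum rσ
    ≡⟨ sym (trans (sum-cong-≗ (λ i → ∑-permute (λ j → ind (r j i)) σ)) (∑-permute _ σ)) ⟩
  fullSum r
    ≡⟨ sym (lowerSum-double r r-sym r-irrefl) ⟩
  lowerSum r + lowerSum r ∎)
  where
  open ≡-Reasoning
  rσ = λ j i → r (σ ⟨$⟩ʳ j) (σ ⟨$⟩ʳ i)

backDegree : Graph m → (Fin m → Fin m) → Fin m → ℕ
backDegree G σ i = sumFin (λ j → ind (does (j <? i) ∧ adj G (σ j) (σ i)))

backDegree≡∑ : (G : Graph m) (σ : Fin m → Fin m) (i : Fin m) →
  backDegree G σ i ≡ ∑[ j < m ] ind (does (j <? i) ∧ adj G (σ j) (σ i))
backDegree≡∑ G σ i = sumFin≡∑ (λ j → ind (does (j <? i) ∧ adj G (σ j) (σ i)))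

module _ (G : Graph m) where

  numEdges≡lowerSum : numEdges G ≡ lowerSum (adj G)
  numEdges≡lowerSum = begin
    numEdges G
      ≡⟨ trans (sumFin≡∑ (λ i → sumFin (λ j → ind (does (i <? j) ∧ adj G i j))))
               (sum-cong-≗ (λ i → sumFin≡∑ (λ j → ind (does (i <? j) ∧ adj G i j)))) ⟩
    ∑[ i < m ] ∑[ j < m ] ind (does (i <? j) ∧ adj G i j)
      ≡⟨ ∑-comm (λ i j → ind (does (i <? j) ∧ adj G i j)) ⟩
    lowerSum (adj G) ∎
    where open ≡-Reasoning

  ∑-backDegree : (σ : Permutation′ m) → ∑ (backDegree G (σ ⟨$⟩ʳ_)) ≡ numEdges G
  ∑-backDegree σ = begin
    ∑ (backDegree G (σ ⟨$⟩ʳ_))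
      ≡⟨ sum-cong-≗ (backDegree≡∑ G (σ ⟨$⟩ʳ_)) ⟩
    lowerSum (λ j i → adj G (σ ⟨$⟩ʳ j) (σ ⟨$⟩ʳ i))
      ≡⟨ lowerSum-permute (adj G) (Graph.sym G) (irrefl G) σ ⟩
    lowerSum (adj G)
      ≡⟨ sym numEdges≡lowerSum ⟩
    numEdges G ∎
    where open ≡-Reasoning

module _ (G : Graph (suc n)) where

  backDegree-last : (σ : Permutation′ (suc n)) →
    backDegree G (σ ⟨$⟩ʳ_) (fromℕ n) ≡ deg G (σ ⟨$⟩ʳ fromℕ n)
  backDegree-last σ = begin
    backDegree G σʳ (fromℕ n)
      ≡⟨ backDegree≡∑ G σʳ (fromℕ n) ⟩
    ∑[ j < suc n ] ind (does (j <? fromℕ n) ∧ adj G (σʳ j) v)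
      ≡⟨ sum-cong-≗ earlier-neighbour ⟩
    ∑[ j < suc n ] ind (adj G v (σʳ j))
      ≡⟨ sym (∑-permute (ind ∘ adj G v) σ) ⟩
    ∑ (ind ∘ adj G v)
      ≡⟨ sym (sumFin≡∑ (ind ∘ adj G v)) ⟩
    deg G v ∎
    where
    open ≡-Reasoning
    σʳ = σ ⟨$⟩ʳ_
    v = σʳ (fromℕ n)
    earlier-neighbour : ∀ j → ind (does (j <? fromℕ n) ∧ adj G (σʳ j) v) ≡ ind (adj G v (σʳ j))
    earlier-neighbour j = ind-does-∧ (j <? fromℕ n) _ _ (λ _ → Graph.sym G (σʳ j) v)
      (λ j≮ → subst (λ w → adj G v (σʳ w) ≡ false) (sym (≮fromℕ⇒≡fromℕ j j≮)) (irrefl G v))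

  -- τ is the ordering σ of G with position i (holding vertex v) deleted, so the
  -- back-degree of σ at a position ≠ i splits off the contribution of v.
  backDegree-punchIn : {σ : Fin (suc n) → Fin (suc n)} {τ : Fin n → Fin n} (i v : Fin (suc n)) →
    (∀ j → σ (punchIn i j) ≡ punchIn v (τ j)) → ∀ k →
    backDegree G σ (punchIn i k) ≡
      ind (does (i <? punchIn i k) ∧ adj G (σ i) (σ (punchIn i k))) + backDegree (deleteVertex G v) τ k
  backDegree-punchIn {σ} {τ} i v σ∘punchIn k = begin
    backDegree G σ p
      ≡⟨ trans (backDegree≡∑ G σ p) (sum-remove {i = i} earlier) ⟩
    earlier i + ∑[ j < n ] earlier (punchIn i j)
      ≡⟨ cong (earlier i +_) (trans (sum-cong-≗ deleted) (sym (backDegree≡∑ (deleteVertex G v) τ k))) ⟩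
    earlier i + backDegree (deleteVertex G v) τ k ∎
    where
    open ≡-Reasoning
    p = punchIn i k
    earlier : Fin (suc n) → ℕ
    earlier j = ind (does (j <? p) ∧ adj G (σ j) (σ p))
    deleted : ∀ j → earlier (punchIn i j) ≡ ind (does (j <? k) ∧ adj G (punchIn v (τ j)) (punchIn v (τ k)))
    deleted j = cong₂ (λ b x → ind (b ∧ x)) (punchIn-<-does i j k)
                      (cong₂ (adj G) (σ∘punchIn j) (σ∘punchIn k))

degenerate⇒goodVertex : (G : Graph (suc n)) (κ : Fin (suc n) → ℕ) →
  Degenerate G κ → Σ (Fin (suc n)) (GoodVertex G κ)
degenerate⇒goodVertex {n} G κ (σ , back≤κ) = v , deg≤κ , edges≤
  where
  open ℕ.≤-Reasoning
  last = fromℕ n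
  v = σ ⟨$⟩ʳ last
  κσ = κ ∘ (σ ⟨$⟩ʳ_)
  deg≤κ : deg G v ≤ κ v
  deg≤κ = subst (_≤ κ v) (backDegree-last G σ) (back≤κ last)
  rest = ∑[ k < n ] backDegree G (σ ⟨$⟩ʳ_) (punchIn last k)
  edges≤ : κ v + numEdges G ≤ sumFin κ + deg G v
  edges≤ = begin
    κ v + numEdges G
      ≡⟨ cong (κ v +_) (trans (sym (∑-backDegree G σ)) (sum-remove {i = last} (backDegree G (σ ⟨$⟩ʳ_)))) ⟩
    κ v + (backDegree G (σ ⟨$⟩ʳ_) last + rest)
      ≡⟨ cong (λ d → κ v + (d + rest)) (backDegree-last G σ) ⟩
    κ v + (deg G v + rest)
      ≤⟨ +-monoʳ-≤ (κ v) (+-monoʳ-≤ (deg G v) (∑-mono-≤ (back≤κ ∘ punchIn last))) ⟩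
    κ v + (deg G v + ∑[ k < n ] κσ (punchIn last k))
      ≡⟨ cong (κ v +_) (+-comm (deg G v) _) ⟩
    κ v + (∑[ k < n ] κσ (punchIn last k) + deg G v)
      ≡⟨ sym (+-assoc (κ v) _ (deg G v)) ⟩
    (κ v + ∑[ k < n ] κσ (punchIn last k)) + deg G v
      ≡⟨ cong (_+ deg G v) (sym (trans (sumFin≡∑ κ) (trans (∑-permute κ σ) (sum-remove {i = last} κσ)))) ⟩
    sumFin κ + deg G v ∎

degenerate-deleteVertex : (G : Graph (suc n)) (κ : Fin (suc n) → ℕ) (v : Fin (suc n)) →
  Degenerate G κ → Degenerate (deleteVertex G v) (restrict κ v)
degenerate-deleteVertex {n} G κ v (σ , back≤κ) = τ , τ-back≤κ
  where
  open ℕ.≤-Reasoning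
  i = σ ⟨$⟩ˡ v
  τ = remove i σ
  τ-back≤κ : ∀ k → backDegree (deleteVertex G v) (τ ⟨$⟩ʳ_) k ≤ restrict κ v (τ ⟨$⟩ʳ k)
  τ-back≤κ k = begin
    backDegree (deleteVertex G v) (τ ⟨$⟩ʳ_) k
      ≤⟨ m≤n+m _ _ ⟩
    _ + backDegree (deleteVertex G v) (τ ⟨$⟩ʳ_) k
      ≡⟨ sym (backDegree-punchIn G i v (Perm.punchIn-permute′ σ v) k) ⟩
    backDegree G (σ ⟨$⟩ʳ_) (punchIn i k)
      ≤⟨ back≤κ (punchIn i k) ⟩
    κ (σ ⟨$⟩ʳ punchIn i k)
      ≡⟨ cong κ (Perm.punchIn-permute′ σ v k) ⟩
    restrict κ v (τ ⟨$⟩ʳ k) ∎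

degenerate-extend : (G : Graph (suc n)) (κ : Fin (suc n) → ℕ) (v : Fin (suc n)) →
  deg G v ≤ κ v → Degenerate (deleteVertex G v) (restrict κ v) → Degenerate G κ
degenerate-extend {n} G κ v deg≤κ (τ , τ-back≤κ) = σ , back≤κ
  where
  open ℕ.≤-Reasoning
  last = fromℕ n
  σ = insert last v τ
  σ-last : σ ⟨$⟩ʳ last ≡ v
  σ-last = insert-self last v τ
  back≤κ-last : backDegree G (σ ⟨$⟩ʳ_) last ≤ κ (σ ⟨$⟩ʳ last)
  back≤κ-last rewrite backDegree-last G σ | σ-last = deg≤κ
  back≤κ-punchIn : ∀ k → backDegree G (σ ⟨$⟩ʳ_) (punchIn last k) ≤ κ (σ ⟨$⟩ʳ punchIn last k)
  back≤κ-punchIn k = begin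
    backDegree G (σ ⟨$⟩ʳ_) (punchIn last k)
      ≡⟨ backDegree-punchIn G last v (Perm.insert-punchIn last v τ) k ⟩
    ind (does (last <? punchIn last k) ∧ adj G v′ w) + backDegree (deleteVertex G v) (τ ⟨$⟩ʳ_) k
      ≡⟨ cong (λ b → ind (b ∧ adj G v′ w) + backDegree (deleteVertex G v) (τ ⟨$⟩ʳ_) k)
              (dec-false (last <? punchIn last k) (fromℕ-≮ (punchIn last k))) ⟩
    backDegree (deleteVertex G v) (τ ⟨$⟩ʳ_) k
      ≤⟨ τ-back≤κ k ⟩
    restrict κ v (τ ⟨$⟩ʳ k)
      ≡⟨ cong κ (sym (Perm.insert-punchIn last v τ k)) ⟩
    κ (σ ⟨$⟩ʳ punchIn last k) ∎
    where
    v′ = σ ⟨$⟩ʳ last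
    w = σ ⟨$⟩ʳ punchIn last k
  back≤κ : ∀ p → backDegree G (σ ⟨$⟩ʳ_) p ≤ κ (σ ⟨$⟩ʳ p)
  back≤κ p = [ (λ last≡p → subst Fine last≡p back≤κ-last)
             , (λ (k , eq) → subst Fine eq (back≤κ-punchIn k)) ]′ (≡-or-punchIn last p)
    where
    Fine : Fin (suc n) → Set
    Fine q = backDegree G (σ ⟨$⟩ʳ_) q ≤ κ (σ ⟨$⟩ʳ q)

proposition2 : (n : ℕ) (G : Graph (suc n)) (κ : Fin (suc n) → ℕ) →
    (Degenerate G κ → Σ (Fin (suc n)) (λ v → GoodVertex G κ v))
    × ((v : Fin (suc n)) → GoodVertex G κ v →
    Degenerate G κ ⇔ Degenerate (deleteVertex G v) (restrict κ v))
proposition2 n G κ =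
  degenerate⇒goodVertex G κ ,
  λ v good → mk⇔ (degenerate-deleteVertex G κ v) (degenerate-extend G κ v (proj₁ good))
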